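{- Let $g(n)$ denote the number of maximal independent sets of the para-hexagonal cactus $G(n)$. Then $g(1)=5$, $g(2)=19$, $g(3)=76$, and $g(n)=5g(n-1)-4g(n-2)+g(n-3)$ for all $n\ge 4$.
   Context: For $n\ge 1$, the para-hexagonal cactus $G(n)$ is the graph formed by a chain of $n$ 6-cycles $B_1,\dots,B_n$, where for each $1\le i\le n-1$ the consecutive cycles $B_i$ and $B_{i+1}$ share exactly one vertex, non-consecutive cycles share no vertex, every vertex lies in at most two cycles, and for each $2\le i\le n-1$ the two shared (cut) vertices of $B_i$ are at distance three in $B_i$ (antipodal vertices of the hexagon). An independent set is maximal if no further vertex can be added while keeping it independent. -}

module Defs where

open import Data.Bool using (Bool; true; false; _∧_; _∨_; T)
open import Data.Nat using (ℕ; zero; suc; _+_; _*_; _≡ᵇ_)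
open import Data.Fin using (Fin; toℕ)
open import Data.Fin.Subset using (Subset; _∈_; _∉_; _∪_; ⁅_⁆)
open import Data.Fin.Subset.Properties using (_∈?_)
open import Data.Fin.Properties using (all?)
open import Data.List using (List; []; _∷_; map; _++_; filter; length)
open import Data.Vec using (Vec; []; _∷_)
open import Data.Product using (_×_)
open import Relation.Nullary using (¬_; Dec)
open import Relation.Nullary.Decidable using (_×-dec_; _→-dec_; ¬?)

record Graph : Set where
  field
    size : ℕ
    adj  : Fin size → Fin size → Bool

open Graph public

Adj : (G : Graph) → Fin (size G) → Fin (size G) → Set
Adj G u v = T (adj G u v)

IsIndependent : (G : Graph) → Subset (size G) → Set
IsIndependent G S = ∀ u v → u ∈ S → v ∈ S → ¬ Adj G u v

IsMaximalIndependent : (G : Graph) → Subset (size G) → Set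
IsMaximalIndependent G S =
  IsIndependent G S × (∀ v → v ∉ S → ¬ IsIndependent G (⁅ v ⁆ ∪ S))

isIndependent? : (G : Graph) → (S : Subset (size G)) → Dec (IsIndependent G S)
isIndependent? G S =
  all? λ u → all? λ v → (u ∈? S) →-dec ((v ∈? S) →-dec ¬? (T? (adj G u v)))
  where
  open import Data.Bool.Properties using (T?)

isMaximalIndependent? : (G : Graph) → (S : Subset (size G)) →
                        Dec (IsMaximalIndependent G S)
isMaximalIndependent? G S =
  isIndependent? G S ×-dec
  all? λ v → ¬? (v ∈? S) →-dec ¬? (isIndependent? G (⁅ v ⁆ ∪ S))

allSubsets : (m : ℕ) → List (Subset m)
allSubsets zero    = [] ∷ []
allSubsets (suc m) = map (false ∷_) (allSubsets m) ++ map (true ∷_) (allSubsets m)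

numMIS : Graph → ℕ
numMIS G = length (filter (isMaximalIndependent? G) (allSubsets (size G)))

-- Cut vertices c_i = 5i (0 ≤ i ≤ n).  Hexagon B_{i+1}
-- (0 ≤ i < n) is the 6-cycle
--   5i — 5i+1 — 5i+2 — 5(i+1) — 5i+3 — 5i+4 — 5i,
-- so consecutive hexagons share the single vertex 5(i+1), and the two
-- cut vertices 5i, 5(i+1) of each hexagon are antipodal (distance 3).

hexEdgeℕ : ℕ → ℕ → ℕ → Bool
hexEdgeℕ i u v =
     pair (5 * i)     (5 * i + 1)
  ∨ pair (5 * i + 1) (5 * i + 2)
  ∨ pair (5 * i + 2) (5 * i + 5)
  ∨ pair (5 * i + 5) (5 * i + 3)
  ∨ pair (5 * i + 3) (5 * i + 4)
  ∨ pair (5 * i + 4) (5 * i)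
  where
  pair : ℕ → ℕ → Bool
  pair a b = ((u ≡ᵇ a) ∧ (v ≡ᵇ b)) ∨ ((u ≡ᵇ b) ∧ (v ≡ᵇ a))

cactusAdjℕ : ℕ → ℕ → ℕ → Bool
cactusAdjℕ zero    u v = false
cactusAdjℕ (suc k) u v = hexEdgeℕ k u v ∨ cactusAdjℕ k u v

paraHexCactus : ℕ → Graph
paraHexCactus n = record
  { size = suc (5 * n)
  ; adj  = λ u v → cactusAdjℕ n (toℕ u) (toℕ v)
  }

g : ℕ → ℕ
g n = numMIS (paraHexCactus n)

-- Root G(n) at its end vertex 0.  Then G(n+1) is a hexagon on the vertices 0..5
-- glued at 5 to a copy of G(n) shifted by 5.  A set is maximal independent iff it
-- is independent, dominates every non-root vertex outside it, and contains or
-- dominates the root.  Sets with the first two properties split into three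
-- classes (root in the set, dominated, free), and the class of a set on G(n+1) is
-- determined by its bits on 0..4 and the class of its restriction to the shifted
-- G(n).  So the class counts evolve by a transfer matrix M, computed by running
-- through the 32 bit patterns on 0..4; g(n) is a fixed linear form of the counts,
-- and the recurrence is the Cayley–Hamilton relation for the characteristic
-- polynomial x³ − 5x² + 4x − 1 of M.
module Submission where

open import Defs
open import Data.Bool using (Bool; true; false; _∧_; _∨_; T; if_then_else_)
open import Data.Bool.Properties using (∨-comm; ∧-comm; ∨-identityʳ; T-∨; T-∧; T-≡; T?)
open import Data.Empty using (⊥; ⊥-elim)
open import Data.Fin using (Fin; toℕ; fromℕ<) renaming (zero to fzero; suc to fsuc)
open import Data.Fin.Properties using (any?; toℕ<n; toℕ-fromℕ<)
open import Data.Fin.Subset using (_∈_; _∉_; _∪_; ⁅_⁆)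
open import Data.Fin.Subset.Properties using (_∈?_; x∈p∪q⁻; x∈p∪q⁺; x∈⁅x⁆; x∈⁅y⁆⇒x≡y)
open import Data.List using (List; []; _∷_; length; filter; map; _++_)
open import Data.Nat using (ℕ; zero; suc; _+_; _*_; _∸_; _≥_; _<_; _≡ᵇ_; s≤s; z<s; s<s)
open import Data.Nat.Properties
  using (_<?_; ≡ᵇ⇒≡; ≮⇒≥; m≤n⇒∃[o]m+o≡n; ≤-trans; m≤m*n; +-monoʳ-<; +-cancelˡ-<; *-suc; +-suc;
         +-assoc; +-identityʳ; *-identityʳ; *-zeroʳ; *-assoc; *-distribˡ-+; *-distribʳ-+)
open import Data.Nat.Tactic.RingSolver using (solve-∀)
import Data.Product as Product
open import Data.Product using (_×_; _,_; ∃; proj₁; proj₂)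
import Data.Sum as Sum
open import Data.Sum using (_⊎_; inj₁; inj₂; [_,_]′)
open import Data.Vec using (Vec; []; _∷_; lookup) renaming (_++_ to _++ᵛ_)
open import Data.Vec.Properties using ([]=⇒lookup; lookup⇒[]=)
open import Function using (_∘_; id; _⇔_; mk⇔; Equivalence)
open import Relation.Nullary using (¬_; Dec; yes; no; does)
open import Relation.Nullary.Decidable using (_×-dec_; _⊎-dec_; ¬?; dec-true; dec-false)
open import Relation.Binary.PropositionalEquality
  using (_≡_; refl; sym; trans; cong; cong₂; subst; module ≡-Reasoning)
open ≡-Reasoning

edgeTest : (u v a b : ℕ) → Bool
edgeTest u v a b = ((u ≡ᵇ a) ∧ (v ≡ᵇ b)) ∨ ((u ≡ᵇ b) ∧ (v ≡ᵇ a))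

-- hexEdgeℕ i unfolds definitionally to hexagonAt (5 * i).
hexagonAt : ℕ → ℕ → ℕ → Bool
hexagonAt c u v =
     edgeTest u v c       (c + 1)
  ∨ edgeTest u v (c + 1) (c + 2)
  ∨ edgeTest u v (c + 2) (c + 5)
  ∨ edgeTest u v (c + 5) (c + 3)
  ∨ edgeTest u v (c + 3) (c + 4)
  ∨ edgeTest u v (c + 4) c

edgeTest-sym : ∀ u v a b → edgeTest v u a b ≡ edgeTest u v a b
edgeTest-sym u v a b =
  trans (∨-comm ((v ≡ᵇ a) ∧ (u ≡ᵇ b)) _)
        (cong₂ _∨_ (∧-comm (v ≡ᵇ b) (u ≡ᵇ a)) (∧-comm (v ≡ᵇ a) (u ≡ᵇ b)))

hexagonAt-sym : ∀ c u v → hexagonAt c v u ≡ hexagonAt c u v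
hexagonAt-sym c u v =
  cong₂ _∨_ (swap _ _) (cong₂ _∨_ (swap _ _) (cong₂ _∨_ (swap _ _)
    (cong₂ _∨_ (swap _ _) (cong₂ _∨_ (swap _ _) (swap _ _)))))
  where
  swap : ∀ a b → edgeTest v u a b ≡ edgeTest u v a b
  swap = edgeTest-sym u v

data HexEdge : ℕ → ℕ → Set where
  e01 : HexEdge 0 1
  e10 : HexEdge 1 0
  e12 : HexEdge 1 2
  e21 : HexEdge 2 1
  e25 : HexEdge 2 5
  e52 : HexEdge 5 2
  e53 : HexEdge 5 3
  e35 : HexEdge 3 5
  e34 : HexEdge 3 4
  e43 : HexEdge 4 3
  e40 : HexEdge 4 0
  e04 : HexEdge 0 4

HexEdge-sym : ∀ {u v} → HexEdge u v → HexEdge v u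
HexEdge-sym e01 = e10
HexEdge-sym e10 = e01
HexEdge-sym e12 = e21
HexEdge-sym e21 = e12
HexEdge-sym e25 = e52
HexEdge-sym e52 = e25
HexEdge-sym e53 = e35
HexEdge-sym e35 = e53
HexEdge-sym e34 = e43
HexEdge-sym e43 = e34
HexEdge-sym e40 = e04
HexEdge-sym e04 = e40

edgeTest-sound : ∀ u v a b → T (edgeTest u v a b) → (u ≡ a × v ≡ b) ⊎ (u ≡ b × v ≡ a)
edgeTest-sound u v a b = Sum.map (endpoints a b) (endpoints b a) ∘ Equivalence.to T-∨
  where
  endpoints : ∀ a b → T ((u ≡ᵇ a) ∧ (v ≡ᵇ b)) → u ≡ a × v ≡ b
  endpoints a b = Product.map (≡ᵇ⇒≡ u a) (≡ᵇ⇒≡ v b) ∘ Equivalence.to T-∧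

orient : ∀ {u v a b} → HexEdge a b → T (edgeTest u v a b) → HexEdge u v
orient {u} {v} {a} {b} e p with edgeTest-sound u v a b p
... | inj₁ (refl , refl) = e
... | inj₂ (refl , refl) = HexEdge-sym e

firstHexagonEdge : ∀ u v → T (hexEdgeℕ 0 u v) → HexEdge u v
firstHexagonEdge u v =
  [ orient e01 , [ orient e12 , [ orient e25 , [ orient e53 , [ orient e34 , orient e40 ]′
  ∘ split ]′ ∘ split ]′ ∘ split ]′ ∘ split ]′ ∘ split
  where
  split : ∀ {x y} → T (x ∨ y) → T x ⊎ T y
  split = Equivalence.to T-∨

hexEdge-sound : ∀ {u v} → HexEdge u v → T (hexEdgeℕ 0 u v)
hexEdge-sound e01 = _
hexEdge-sound e10 = _
hexEdge-sound e12 = _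
hexEdge-sound e21 = _
hexEdge-sound e25 = _
hexEdge-sound e52 = _
hexEdge-sound e53 = _
hexEdge-sound e35 = _
hexEdge-sound e34 = _
hexEdge-sound e43 = _
hexEdge-sound e40 = _
hexEdge-sound e04 = _

Adjℕ : ℕ → ℕ → ℕ → Set
Adjℕ n u v = T (cactusAdjℕ n u v)

cactusAdj-sym : ∀ n u v → cactusAdjℕ n v u ≡ cactusAdjℕ n u v
cactusAdj-sym zero    u v = refl
cactusAdj-sym (suc n) u v = cong₂ _∨_ (hexagonAt-sym (5 * n) u v) (cactusAdj-sym n u v)

Adjℕ-sym : ∀ n u v → Adjℕ n u v → Adjℕ n v u
Adjℕ-sym n u v = subst T (sym (cactusAdj-sym n u v))

firstHexagon-above : ∀ u v → hexEdgeℕ 0 (5 + u) (5 + v) ≡ false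
firstHexagon-above zero    v = refl
firstHexagon-above (suc u) v = refl

cactusAdj-shift : ∀ n u v → cactusAdjℕ (suc n) (5 + u) (5 + v) ≡ cactusAdjℕ n u v
cactusAdj-shift zero    u v = cong (_∨ false) (firstHexagon-above u v)
cactusAdj-shift (suc n) u v =
  cong₂ _∨_ (cong (λ c → hexagonAt c (5 + u) (5 + v)) (*-suc 5 n)) (cactusAdj-shift n u v)

laterHexagon-avoids : ∀ i {u} v → u < 5 → hexEdgeℕ (suc i) u v ≡ false
laterHexagon-avoids i {u} v u<5 = trans (cong (λ c → hexagonAt c u v) (*-suc 5 i)) (avoids u<5)
  where
  avoids : ∀ {u} → u < 5 → hexagonAt (5 + 5 * i) u v ≡ false
  avoids z<s                         = refl
  avoids (s<s z<s)                   = refl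
  avoids (s<s (s<s z<s))             = refl
  avoids (s<s (s<s (s<s z<s)))       = refl
  avoids (s<s (s<s (s<s (s<s z<s)))) = refl

firstHexagon-only : ∀ n {u} v → u < 5 → cactusAdjℕ (suc n) u v ≡ hexEdgeℕ 0 u v
firstHexagon-only zero    {u} v _ = ∨-identityʳ (hexEdgeℕ 0 u v)
firstHexagon-only (suc n) v u<5 =
  cong₂ _∨_ (laterHexagon-avoids n v u<5) (firstHexagon-only n v u<5)

data CactusEdge (n : ℕ) : ℕ → ℕ → Set where
  inFirst : ∀ {u v} → HexEdge u v → CactusEdge n u v
  shifted : ∀ {u v} → Adjℕ n u v → CactusEdge n (5 + u) (5 + v)

cactusEdge : ∀ n u v → Adjℕ (suc n) u v → CactusEdge n u v
cactusEdge n u v p with u <? 5 | v <? 5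
... | yes u<5 | _       = inFirst (firstHexagonEdge u v (subst T (firstHexagon-only n v u<5) p))
... | no _    | yes v<5 =
  inFirst (HexEdge-sym (firstHexagonEdge v u
    (subst T (firstHexagon-only n u v<5) (Adjℕ-sym (suc n) u v p))))
... | no u≮5  | no v≮5  with m≤n⇒∃[o]m+o≡n (≮⇒≥ u≮5) | m≤n⇒∃[o]m+o≡n (≮⇒≥ v≮5)
...   | u′ , refl | v′ , refl = shifted (subst T (cactusAdj-shift n u′ v′) p)

hexEdge⇒Adj : ∀ n {u v} → HexEdge u v → Adjℕ (suc n) u v
hexEdge⇒Adj zero    e = Equivalence.from T-∨ (inj₁ (hexEdge-sound e))
hexEdge⇒Adj (suc n) {u} {v} e =
  Equivalence.from (T-∨ {hexEdgeℕ (suc n) u v}) (inj₂ (hexEdge⇒Adj n e))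

shift⇒Adj : ∀ n {u v} → Adjℕ n u v → Adjℕ (suc n) (5 + u) (5 + v)
shift⇒Adj n {u} {v} = subst T (sym (cactusAdj-shift n u v))

Adjℕ-irrefl : ∀ n u → ¬ Adjℕ n u u
Adjℕ-irrefl zero    u ()
Adjℕ-irrefl (suc n) u p = irrefl (cactusEdge n u u p)
  where
  irrefl : ∀ {u} → ¬ CactusEdge n u u
  irrefl (shifted q) = Adjℕ-irrefl n _ q

Independent : ℕ → (ℕ → Bool) → Set
Independent n X = ∀ u v → T (X u) → T (X v) → ¬ Adjℕ n u v

Dominated : ℕ → (ℕ → Bool) → ℕ → Set
Dominated n X v = ∃ λ u → T (X u) × Adjℕ n u v

DominatesNonRoot : ℕ → (ℕ → Bool) → Set
DominatesNonRoot n X = ∀ v → v < 5 * n → ¬ T (X (suc v)) → Dominated n X (suc v)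

Admissible : ℕ → (ℕ → Bool) → Set
Admissible n X = Independent n X × DominatesNonRoot n X

data Class : Set where
  rootIn rootDominated rootFree inadmissible : Class

HasClass : ℕ → (ℕ → Bool) → Class → Set
HasClass n X rootIn        = Admissible n X × T (X 0)
HasClass n X rootDominated = Admissible n X × ¬ T (X 0) × Dominated n X 0
HasClass n X rootFree      = Admissible n X × ¬ T (X 0) × ¬ Dominated n X 0
HasClass n X inadmissible  = ¬ Admissible n X

NotBoth : Bool → Bool → Set
NotBoth x y = ¬ (T x × T y)

notBoth? : ∀ x y → Dec (NotBoth x y)
notBoth? x y = ¬? (T? x ×-dec T? y)

-- The bits of the hexagon 0-1-2-5-3-4-0, with t the bit of vertex 5 and d
-- recording whether vertex 5 is dominated inside the rest of the cactus.
HexagonIndependent : (b0 b1 b2 b3 b4 t : Bool) → Set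
HexagonIndependent b0 b1 b2 b3 b4 t =
  NotBoth b0 b1 × NotBoth b1 b2 × NotBoth b2 t × NotBoth t b3 × NotBoth b3 b4 × NotBoth b4 b0

HexagonDominated : (b0 b1 b2 b3 b4 t d : Bool) → Set
HexagonDominated b0 b1 b2 b3 b4 t d =
  (T b1 ⊎ T b0 ⊎ T b2) × (T b2 ⊎ T b1 ⊎ T t) × (T b3 ⊎ T t ⊎ T b4) ×
  (T b4 ⊎ T b3 ⊎ T b0) × (T t ⊎ T b2 ⊎ T b3 ⊎ T d)

HexagonCondition : (b0 b1 b2 b3 b4 t d : Bool) → Set
HexagonCondition b0 b1 b2 b3 b4 t d =
  HexagonIndependent b0 b1 b2 b3 b4 t × HexagonDominated b0 b1 b2 b3 b4 t d

hexagonCondition? : ∀ b0 b1 b2 b3 b4 t d → Dec (HexagonCondition b0 b1 b2 b3 b4 t d)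
hexagonCondition? b0 b1 b2 b3 b4 t d =
  (notBoth? b0 b1 ×-dec notBoth? b1 b2 ×-dec notBoth? b2 t ×-dec notBoth? t b3 ×-dec
   notBoth? b3 b4 ×-dec notBoth? b4 b0) ×-dec
  ((T? b1 ⊎-dec T? b0 ⊎-dec T? b2) ×-dec (T? b2 ⊎-dec T? b1 ⊎-dec T? t) ×-dec
   (T? b3 ⊎-dec T? t ⊎-dec T? b4) ×-dec (T? b4 ⊎-dec T? b3 ⊎-dec T? b0) ×-dec
   (T? t ⊎-dec T? b2 ⊎-dec T? b3 ⊎-dec T? d))

rootClass : (b0 b1 b4 : Bool) → Class
rootClass true  _  _  = rootIn
rootClass false b1 b4 = if b1 ∨ b4 then rootDominated else rootFree

extend : (b0 b1 b2 b3 b4 : Bool) → Class → Class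
extend b0 b1 b2 b3 b4 rootIn =
  if does (hexagonCondition? b0 b1 b2 b3 b4 true false) then rootClass b0 b1 b4 else inadmissible
extend b0 b1 b2 b3 b4 rootDominated =
  if does (hexagonCondition? b0 b1 b2 b3 b4 false true) then rootClass b0 b1 b4 else inadmissible
extend b0 b1 b2 b3 b4 rootFree =
  if does (hexagonCondition? b0 b1 b2 b3 b4 false false) then rootClass b0 b1 b4 else inadmissible
extend b0 b1 b2 b3 b4 inadmissible = inadmissible

bit : ∀ {m} → Vec Bool m → ℕ → Bool
bit []      _       = false
bit (b ∷ w) zero    = b
bit (b ∷ w) (suc k) = bit w k

-- Only vectors of length 1 + 5n are meaningful; the last clause is junk.
classify : ∀ {m} → Vec Bool m → Class
classify (t ∷ [])                          = if t then rootIn else rootFree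
classify (b0 ∷ b1 ∷ b2 ∷ b3 ∷ b4 ∷ t ∷ w) = extend b0 b1 b2 b3 b4 (classify (t ∷ w))
classify _                                 = inadmissible

rootClass-hasClass : ∀ {n X} b0 b1 b4 → X 0 ≡ b0 → Admissible n X →
                    Dominated n X 0 ⇔ (T b1 ⊎ T b4) → HasClass n X (rootClass b0 b1 b4)
rootClass-hasClass true  _     _     x0 adm _   = adm , subst T (sym x0) _
rootClass-hasClass false true  _     x0 adm dom = adm , subst T x0 , Equivalence.from dom (inj₁ _)
rootClass-hasClass false false true  x0 adm dom = adm , subst T x0 , Equivalence.from dom (inj₂ _)
rootClass-hasClass false false false x0 adm dom = adm , subst T x0 , [ id , id ]′ ∘ Equivalence.to dom

module Extension (n : ℕ) (b0 b1 b2 b3 b4 t : Bool) {m} (w : Vec Bool m) where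

  X Y : ℕ → Bool
  X = bit (t ∷ w)
  Y = bit (b0 ∷ b1 ∷ b2 ∷ b3 ∷ b4 ∷ t ∷ w)

  shiftDominated : ∀ {v} → Dominated n X v → Dominated (suc n) Y (5 + v)
  shiftDominated (u , Xu , a) = 5 + u , Xu , shift⇒Adj n a

  dominatedVia : ∀ {u v} → HexEdge u v → T (Y u) → Dominated (suc n) Y v
  dominatedVia e Yu = _ , Yu , hexEdge⇒Adj n e

  byNeighbour : ∀ {v} {A : Set} → (∀ {u} → CactusEdge n u v → T (Y u) → A) →
                Dominated (suc n) Y v → A
  byNeighbour f (u , Yu , a) = f (cactusEdge n u _ a) Yu

  independent-extend : HexagonIndependent b0 b1 b2 b3 b4 t → Independent n X → Independent (suc n) Y
  independent-extend (i01 , i12 , i25 , i53 , i34 , i40) indX u v Yu Yv a = go (cactusEdge n u v a) Yu Yv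
    where
    go : ∀ {u v} → CactusEdge n u v → T (Y u) → T (Y v) → ⊥
    go (inFirst e01) p q = i01 (p , q)
    go (inFirst e10) p q = i01 (q , p)
    go (inFirst e12) p q = i12 (p , q)
    go (inFirst e21) p q = i12 (q , p)
    go (inFirst e25) p q = i25 (p , q)
    go (inFirst e52) p q = i25 (q , p)
    go (inFirst e53) p q = i53 (p , q)
    go (inFirst e35) p q = i53 (q , p)
    go (inFirst e34) p q = i34 (p , q)
    go (inFirst e43) p q = i34 (q , p)
    go (inFirst e40) p q = i40 (p , q)
    go (inFirst e04) p q = i40 (q , p)
    go (shifted a)   p q = indX _ _ p q a

  dominates-extend : ∀ {d} → HexagonDominated b0 b1 b2 b3 b4 t d → (T d → Dominated n X 0) →
                     DominatesNonRoot n X → DominatesNonRoot (suc n) Y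
  dominates-extend (d1 , d2 , d3 , d4 , d5) d⇒dom domX = dom
    where
    dom : DominatesNonRoot (suc n) Y
    dom 0 _ ¬Y1 = [ ⊥-elim ∘ ¬Y1 , [ dominatedVia e01 , dominatedVia e21 ]′ ]′ d1
    dom 1 _ ¬Y2 = [ ⊥-elim ∘ ¬Y2 , [ dominatedVia e12 , dominatedVia e52 ]′ ]′ d2
    dom 2 _ ¬Y3 = [ ⊥-elim ∘ ¬Y3 , [ dominatedVia e53 , dominatedVia e43 ]′ ]′ d3
    dom 3 _ ¬Y4 = [ ⊥-elim ∘ ¬Y4 , [ dominatedVia e34 , dominatedVia e04 ]′ ]′ d4
    dom 4 _ ¬Y5 =
      [ ⊥-elim ∘ ¬Y5 , [ dominatedVia e25 , [ dominatedVia e35 , shiftDominated ∘ d⇒dom ]′ ]′ ]′ d5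
    dom (suc (suc (suc (suc (suc v))))) v<5n ¬Y =
      shiftDominated (domX v (+-cancelˡ-< 5 v (5 * n) (subst (5 + v <_) (*-suc 5 n) v<5n)) ¬Y)

  admissible-restrict : Admissible (suc n) Y → Admissible n X
  admissible-restrict (ind , dom) = (λ u v p q a → ind (5 + u) (5 + v) p q (shift⇒Adj n a)) , domX
    where
    unshift : ∀ {u v} → CactusEdge n u (6 + v) → T (Y u) → Dominated n X (suc v)
    unshift (shifted a) Yu = _ , Yu , a
    domX : DominatesNonRoot n X
    domX v v<5n ¬X =
      byNeighbour unshift (dom (5 + v) (subst (5 + v <_) (sym (*-suc 5 n)) (+-monoʳ-< 5 v<5n)) ¬X)

  independent⇒hexagon : Independent (suc n) Y → HexagonIndependent b0 b1 b2 b3 b4 t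
  independent⇒hexagon ind = edge e01 , edge e12 , edge e25 , edge e53 , edge e34 , edge e40
    where
    edge : ∀ {u v} → HexEdge u v → NotBoth (Y u) (Y v)
    edge e (p , q) = ind _ _ p q (hexEdge⇒Adj n e)

  dominates⇒hexagon : ∀ {d} → DominatesNonRoot (suc n) Y → (¬ T t → Dominated n X 0 → T d) →
                      HexagonDominated b0 b1 b2 b3 b4 t d
  dominates⇒hexagon {d} dom d⇐dom =
    covered 0 z<s from1 , covered 1 (s<s z<s) from2 , covered 2 (s<s (s<s z<s)) from3 ,
    covered 3 (s<s (s<s (s<s z<s))) from4 , covered 4 (s<s (s<s (s<s (s<s z<s)))) from5
    where
    covered : ∀ v {A : Set} → v < 5 → (¬ T (Y (suc v)) → ∀ {u} → CactusEdge n u (suc v) → T (Y u) → A) →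
              T (Y (suc v)) ⊎ A
    covered v v<5 from with T? (Y (suc v))
    ... | yes p  = inj₁ p
    ... | no ¬p = inj₂ (byNeighbour (from ¬p) (dom v (≤-trans v<5 (m≤m*n 5 (suc n))) ¬p))
    from1 : _ → ∀ {u} → CactusEdge n u 1 → T (Y u) → T b0 ⊎ T b2
    from1 _ (inFirst e01) = inj₁
    from1 _ (inFirst e21) = inj₂
    from2 : _ → ∀ {u} → CactusEdge n u 2 → T (Y u) → T b1 ⊎ T t
    from2 _ (inFirst e12) = inj₁
    from2 _ (inFirst e52) = inj₂
    from3 : _ → ∀ {u} → CactusEdge n u 3 → T (Y u) → T t ⊎ T b4
    from3 _ (inFirst e53) = inj₁
    from3 _ (inFirst e43) = inj₂
    from4 : _ → ∀ {u} → CactusEdge n u 4 → T (Y u) → T b3 ⊎ T b0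
    from4 _ (inFirst e34) = inj₁
    from4 _ (inFirst e04) = inj₂
    from5 : ¬ T t → ∀ {u} → CactusEdge n u 5 → T (Y u) → T b2 ⊎ T b3 ⊎ T d
    from5 _  (inFirst e25) = inj₁
    from5 _  (inFirst e35) = inj₂ ∘ inj₁
    from5 ¬t (shifted a)   = λ Yu → inj₂ (inj₂ (d⇐dom ¬t (_ , Yu , a)))

  rootDominated⇔ : Dominated (suc n) Y 0 ⇔ (T b1 ⊎ T b4)
  rootDominated⇔ = mk⇔ (byNeighbour from0) [ dominatedVia e10 , dominatedVia e40 ]′
    where
    from0 : ∀ {u} → CactusEdge n u 0 → T (Y u) → T b1 ⊎ T b4
    from0 (inFirst e10) = inj₁
    from0 (inFirst e40) = inj₂

  condition⇒hasRootClass : ∀ {d} → HexagonCondition b0 b1 b2 b3 b4 t d → (T d → Dominated n X 0) →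
                   Admissible n X → HasClass (suc n) Y (rootClass b0 b1 b4)
  condition⇒hasRootClass (hexInd , hexDom) d⇒dom (ind , dom) =
    rootClass-hasClass b0 b1 b4 refl
      (independent-extend hexInd ind , dominates-extend hexDom d⇒dom dom) rootDominated⇔

  admissible⇒condition : ∀ {d} → Admissible (suc n) Y → (¬ T t → Dominated n X 0 → T d) →
                         HexagonCondition b0 b1 b2 b3 b4 t d
  admissible⇒condition (ind , dom) d⇐dom = independent⇒hexagon ind , dominates⇒hexagon dom d⇐dom

checked-hasClass : ∀ {n X} {P : Set} (P? : Dec P) {c} → (P → HasClass n X c) →
                   (¬ P → ¬ Admissible n X) → HasClass n X (if does P? then c else inadmissible)
checked-hasClass (yes p)  correct _      = correct p
checked-hasClass (no ¬p) _       reject = reject ¬p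

module _ (n : ℕ) (b0 b1 b2 b3 b4 : Bool) where
  open Extension n b0 b1 b2 b3 b4

  extend-hasClass : ∀ t {m} (w : Vec Bool m) c → HasClass n (bit (t ∷ w)) c →
                    HasClass (suc n) (bit (b0 ∷ b1 ∷ b2 ∷ b3 ∷ b4 ∷ t ∷ w)) (extend b0 b1 b2 b3 b4 c)
  extend-hasClass t w inadmissible ¬adm = ¬adm ∘ admissible-restrict t w
  extend-hasClass true w rootIn (adm , _) =
    checked-hasClass (hexagonCondition? b0 b1 b2 b3 b4 true false)
      (λ ok → condition⇒hasRootClass true w ok (λ ()) adm)
      (λ ¬ok adm′ → ¬ok (admissible⇒condition true w adm′ (λ ¬t _ → ¬t _)))
  extend-hasClass false w rootDominated (adm , _ , dom) =
    checked-hasClass (hexagonCondition? b0 b1 b2 b3 b4 false true)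
      (λ ok → condition⇒hasRootClass false w ok (λ _ → dom) adm)
      (λ ¬ok adm′ → ¬ok (admissible⇒condition false w adm′ _))
  extend-hasClass false w rootFree (adm , _ , ¬dom) =
    checked-hasClass (hexagonCondition? b0 b1 b2 b3 b4 false false)
      (λ ok → condition⇒hasRootClass false w ok (λ ()) adm)
      (λ ¬ok adm′ → ¬ok (admissible⇒condition false w adm′ (λ _ → ¬dom)))
  extend-hasClass false w rootIn        (_ , ())
  extend-hasClass true  w rootDominated (_ , ¬t , _) = ⊥-elim (¬t _)
  extend-hasClass true  w rootFree      (_ , ¬t , _) = ⊥-elim (¬t _)

admissible-base : ∀ X → Admissible 0 X
admissible-base X = (λ _ _ _ _ ()) , (λ _ ())

classify-hasClass : ∀ n (S : Vec Bool (suc (5 * n))) → HasClass n (bit S) (classify S)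
classify-hasClass zero (true ∷ [])  = admissible-base _ , _
classify-hasClass zero (false ∷ []) = admissible-base _ , (λ ()) , λ ()
classify-hasClass (suc n) S = byLayers (cong suc (*-suc 5 n)) S
  where
  byLayers : ∀ {m} → m ≡ 5 + suc (5 * n) → (S : Vec Bool m) → HasClass (suc n) (bit S) (classify S)
  byLayers refl (b0 ∷ b1 ∷ b2 ∷ b3 ∷ b4 ∷ t ∷ w) =
    extend-hasClass n b0 b1 b2 b3 b4 t w (classify (t ∷ w)) (classify-hasClass n (t ∷ w))

bit-lookup : ∀ {m} (S : Vec Bool m) i → bit S (toℕ i) ≡ lookup S i
bit-lookup (b ∷ S) fzero    = refl
bit-lookup (b ∷ S) (fsuc i) = bit-lookup S i

∈⇔bit : ∀ {m} (S : Vec Bool m) i → i ∈ S ⇔ T (bit S (toℕ i))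
∈⇔bit S i = mk⇔
  (λ i∈S → Equivalence.from T-≡ (trans (bit-lookup S i) ([]=⇒lookup i∈S)))
  (λ Si → lookup⇒[]= i S (trans (sym (bit-lookup S i)) (Equivalence.to T-≡ Si)))

bit⇒vertex : ∀ {m} (S : Vec Bool m) u → T (bit S u) → ∃ λ (i : Fin m) → toℕ i ≡ u
bit⇒vertex (b ∷ S) zero    _  = fzero , refl
bit⇒vertex (b ∷ S) (suc u) Su = Product.map fsuc (cong suc) (bit⇒vertex S u Su)

module MaximalIndependent (n : ℕ) (S : Vec Bool (suc (5 * n))) where

  G : Graph
  G = paraHexCactus n

  X : ℕ → Bool
  X = bit S

  independent⇔ : IsIndependent G S ⇔ Independent n X
  independent⇔ = mk⇔ to from
    where
    from : Independent n X → IsIndependent G S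
    from ind i j i∈S j∈S =
      ind (toℕ i) (toℕ j) (Equivalence.to (∈⇔bit S i) i∈S) (Equivalence.to (∈⇔bit S j) j∈S)
    to : IsIndependent G S → Independent n X
    to ind u v Xu Xv with bit⇒vertex S u Xu | bit⇒vertex S v Xv
    ... | i , refl | j , refl =
      ind i j (Equivalence.from (∈⇔bit S i) Xu) (Equivalence.from (∈⇔bit S j) Xv)

  insert-independent : IsIndependent G S → ∀ i → ¬ (∃ λ j → j ∈ S × Adj G j i) →
                       IsIndependent G (⁅ i ⁆ ∪ S)
  insert-independent ind i ¬adj x y x∈ y∈ = go (x∈p∪q⁻ ⁅ i ⁆ S x∈) (x∈p∪q⁻ ⁅ i ⁆ S y∈)
    where
    go : ∀ {x y} → x ∈ ⁅ i ⁆ ⊎ x ∈ S → y ∈ ⁅ i ⁆ ⊎ y ∈ S → ¬ Adj G x y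
    go (inj₁ x∈i) y∈ a with x∈⁅y⁆⇒x≡y i x∈i
    go (inj₁ _) (inj₁ y∈i) a | refl with x∈⁅y⁆⇒x≡y i y∈i
    ... | refl = Adjℕ-irrefl n (toℕ i) a
    go (inj₁ _) (inj₂ y∈S) a | refl = ¬adj (_ , y∈S , Adjℕ-sym n (toℕ i) _ a)
    go (inj₂ x∈S) (inj₁ y∈i) a with x∈⁅y⁆⇒x≡y i y∈i
    ... | refl = ¬adj (_ , x∈S , a)
    go (inj₂ x∈S) (inj₂ y∈S) a = ind _ _ x∈S y∈S a

  -- Maximality only refutes non-domination; deciding the neighbourhood yields a witness.
  maximal⇒dominated : IsMaximalIndependent G S → ∀ i → i ∉ S → Dominated n X (toℕ i)
  maximal⇒dominated (ind , maximal) i i∉S with any? (λ j → (j ∈? S) ×-dec T? (adj G j i))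
  ... | yes (j , j∈S , a) = toℕ j , Equivalence.to (∈⇔bit S j) j∈S , a
  ... | no ¬adj          = ⊥-elim (maximal i i∉S (insert-independent ind i ¬adj))

  dominated⇒maximal : (∀ i → i ∉ S → Dominated n X (toℕ i)) →
                      ∀ i → i ∉ S → ¬ IsIndependent G (⁅ i ⁆ ∪ S)
  dominated⇒maximal dom i i∉S ind with dom i i∉S
  ... | u , Xu , a with bit⇒vertex S u Xu
  ...   | j , refl =
    ind j i (x∈p∪q⁺ (inj₂ (Equivalence.from (∈⇔bit S j) Xu))) (x∈p∪q⁺ (inj₁ (x∈⁅x⁆ i))) a

  maximalIndependent⇔ : IsMaximalIndependent G S ⇔ (Admissible n X × (T (X 0) ⊎ Dominated n X 0))
  maximalIndependent⇔ = mk⇔ to from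
    where
    ∉⇔ : ∀ i → i ∉ S ⇔ (¬ T (X (toℕ i)))
    ∉⇔ i = mk⇔ (λ i∉S → i∉S ∘ Equivalence.from (∈⇔bit S i))
               (λ ¬Xi → ¬Xi ∘ Equivalence.to (∈⇔bit S i))
    to : IsMaximalIndependent G S → Admissible n X × (T (X 0) ⊎ Dominated n X 0)
    to mis = (Equivalence.to independent⇔ (proj₁ mis) , nonRoot) , root
      where
      dom : ∀ i → ¬ T (X (toℕ i)) → Dominated n X (toℕ i)
      dom i = maximal⇒dominated mis i ∘ Equivalence.from (∉⇔ i)
      nonRoot : DominatesNonRoot n X
      nonRoot v v<5n = subst (λ u → ¬ T (X u) → Dominated n X u)
                             (toℕ-fromℕ< (s<s v<5n)) (dom (fromℕ< (s<s v<5n)))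
      root : T (X 0) ⊎ Dominated n X 0
      root with T? (X 0)
      ... | yes X0 = inj₁ X0
      ... | no ¬X0 = inj₂ (dom fzero ¬X0)
    from : Admissible n X × (T (X 0) ⊎ Dominated n X 0) → IsMaximalIndependent G S
    from ((ind , nonRoot) , root) =
      Equivalence.from independent⇔ ind , dominated⇒maximal (λ i → dom i ∘ Equivalence.to (∉⇔ i))
      where
      dom : ∀ i → ¬ T (X (toℕ i)) → Dominated n X (toℕ i)
      dom fzero    ¬X0 = [ ⊥-elim ∘ ¬X0 , id ]′ root
      dom (fsuc k) ¬Xk = nonRoot (toℕ k) (toℕ<n k) ¬Xk

isMaximalClass : Class → Bool
isMaximalClass rootIn        = true
isMaximalClass rootDominated = true
isMaximalClass _             = false

maximalIndependent?≡ : ∀ n (S : Vec Bool (suc (5 * n))) →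
  does (isMaximalIndependent? (paraHexCactus n) S) ≡ isMaximalClass (classify S)
maximalIndependent?≡ n S = byClass (classify S) (classify-hasClass n S)
  where
  open Equivalence (MaximalIndependent.maximalIndependent⇔ n S)
  mis? : Dec (IsMaximalIndependent (paraHexCactus n) S)
  mis? = isMaximalIndependent? (paraHexCactus n) S
  byClass : ∀ c → HasClass n (bit S) c → does mis? ≡ isMaximalClass c
  byClass rootIn        (adm , X0)       = dec-true  mis? (from (adm , inj₁ X0))
  byClass rootDominated (adm , _ , dom)  = dec-true  mis? (from (adm , inj₂ dom))
  byClass rootFree      (_ , ¬X0 , ¬dom) = dec-false mis? ([ ¬X0 , ¬dom ]′ ∘ proj₂ ∘ to)
  byClass inadmissible  ¬adm             = dec-false mis? (¬adm ∘ proj₁ ∘ to)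

indicator : Bool → ℕ
indicator true  = 1
indicator false = 0

count : ∀ {A : Set} → (A → Bool) → List A → ℕ
count p []       = 0
count p (x ∷ xs) = indicator (p x) + count p xs

length-filter : ∀ {A : Set} {P : A → Set} (P? : ∀ x → Dec (P x)) xs →
                length (filter P? xs) ≡ count (does ∘ P?) xs
length-filter P? [] = refl
length-filter P? (x ∷ xs) with does (P? x)
... | true  = cong suc (length-filter P? xs)
... | false = length-filter P? xs

count-cong : ∀ {A : Set} {p q : A → Bool} → (∀ x → p x ≡ q x) → ∀ xs → count p xs ≡ count q xs
count-cong p≡q []       = refl
count-cong p≡q (x ∷ xs) = cong₂ _+_ (cong indicator (p≡q x)) (count-cong p≡q xs)

count-++ : ∀ {A : Set} (p : A → Bool) xs ys → count p (xs ++ ys) ≡ count p xs + count p ys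
count-++ p []       ys = refl
count-++ p (x ∷ xs) ys = trans (cong (indicator (p x) +_) (count-++ p xs ys))
                               (sym (+-assoc (indicator (p x)) (count p xs) (count p ys)))

count-map : ∀ {A B : Set} (p : B → Bool) (f : A → B) xs → count p (map f xs) ≡ count (p ∘ f) xs
count-map p f []       = refl
count-map p f (x ∷ xs) = cong (indicator (p (f x)) +_) (count-map p f xs)

sumOverVecs : ∀ k → (Vec Bool k → ℕ) → ℕ
sumOverVecs zero    h = h []
sumOverVecs (suc k) h = sumOverVecs k (h ∘ (false ∷_)) + sumOverVecs k (h ∘ (true ∷_))

sumOverVecs-cong : ∀ k {h h′ : Vec Bool k → ℕ} → (∀ v → h v ≡ h′ v) →
                   sumOverVecs k h ≡ sumOverVecs k h′
sumOverVecs-cong zero    h≡ = h≡ []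
sumOverVecs-cong (suc k) h≡ =
  cong₂ _+_ (sumOverVecs-cong k (h≡ ∘ (false ∷_))) (sumOverVecs-cong k (h≡ ∘ (true ∷_)))

count-allSubsets-+ : ∀ k {m} (p : Vec Bool (k + m) → Bool) →
  count p (allSubsets (k + m)) ≡ sumOverVecs k (λ v → count (p ∘ (v ++ᵛ_)) (allSubsets m))
count-allSubsets-+ zero    p = refl
count-allSubsets-+ (suc k) {m} p = begin
  count p (map (false ∷_) (allSubsets (k + m)) ++ map (true ∷_) (allSubsets (k + m)))
    ≡⟨ count-++ p (map (false ∷_) (allSubsets (k + m))) (map (true ∷_) (allSubsets (k + m))) ⟩
  count p (map (false ∷_) (allSubsets (k + m))) + count p (map (true ∷_) (allSubsets (k + m)))
    ≡⟨ cong₂ _+_ (count-map p (false ∷_) (allSubsets (k + m)))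
                 (count-map p (true ∷_) (allSubsets (k + m))) ⟩
  count (p ∘ (false ∷_)) (allSubsets (k + m)) + count (p ∘ (true ∷_)) (allSubsets (k + m))
    ≡⟨ cong₂ _+_ (count-allSubsets-+ k (p ∘ (false ∷_))) (count-allSubsets-+ k (p ∘ (true ∷_))) ⟩
  sumOverVecs (suc k) (λ v → count (p ∘ (v ++ᵛ_)) (allSubsets m)) ∎

_==_ : Class → Class → Bool
rootIn        == rootIn        = true
rootDominated == rootDominated = true
rootFree      == rootFree      = true
inadmissible  == inadmissible  = true
_             == _             = false

classSum : (Class → ℕ) → ℕ
classSum f = f rootIn + f rootDominated + f rootFree + f inadmissible

classSum-cong : ∀ {f g : Class → ℕ} → (∀ c → f c ≡ g c) → classSum f ≡ classSum g
classSum-cong f≡g = cong₂ _+_ (cong₂ _+_ (cong₂ _+_ (f≡g _) (f≡g _)) (f≡g _)) (f≡g _)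

classSum-+ : ∀ (f g : Class → ℕ) → classSum (λ c → f c + g c) ≡ classSum f + classSum g
classSum-+ f g = regroup (f rootIn) (f rootDominated) (f rootFree) (f inadmissible)
                         (g rootIn) (g rootDominated) (g rootFree) (g inadmissible)
  where
  regroup : ∀ a b c d a′ b′ c′ d′ →
            a + a′ + (b + b′) + (c + c′) + (d + d′) ≡ a + b + c + d + (a′ + b′ + c′ + d′)
  regroup = solve-∀

classSum-*ˡ : ∀ x (f : Class → ℕ) → x * classSum f ≡ classSum (λ c → x * f c)
classSum-*ˡ x f = distribute x (f rootIn) (f rootDominated) (f rootFree) (f inadmissible)
  where
  distribute : ∀ x a b c d → x * (a + b + c + d) ≡ x * a + x * b + x * c + x * d
  distribute = solve-∀

classSum-*ʳ : ∀ (f : Class → ℕ) x → classSum f * x ≡ classSum (λ c → f c * x)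
classSum-*ʳ f x = distribute x (f rootIn) (f rootDominated) (f rootFree) (f inadmissible)
  where
  distribute : ∀ x a b c d → (a + b + c + d) * x ≡ a * x + b * x + c * x + d * x
  distribute = solve-∀

classSum-comm : ∀ (F : Class → Class → ℕ) →
  classSum (λ c → classSum (F c)) ≡ classSum (λ c′ → classSum (λ c → F c c′))
classSum-comm F =
  trans (classSum-+ (λ c → F c rootIn + F c rootDominated + F c rootFree) (λ c → F c inadmissible))
  (cong (_+ classSum (λ c → F c inadmissible))
    (trans (classSum-+ (λ c → F c rootIn + F c rootDominated) (λ c → F c rootFree))
    (cong (_+ classSum (λ c → F c rootFree)) (classSum-+ (λ c → F c rootIn) (λ c → F c rootDominated)))))

classSum-indicator : ∀ (f : Class → ℕ) c₀ → classSum (λ c → f c * indicator (c == c₀)) ≡ f c₀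
classSum-indicator f c₀ = trans (classSum-cong (λ c → *-indicator (f c) (c == c₀))) (single c₀)
  where
  *-indicator : ∀ x b → x * indicator b ≡ (if b then x else 0)
  *-indicator x true  = *-identityʳ x
  *-indicator x false = *-zeroʳ x
  single : ∀ c₀ → classSum (λ c → if c == c₀ then f c else 0) ≡ f c₀
  single rootIn        =
    trans (+-identityʳ (f rootIn + 0 + 0)) (trans (+-identityʳ (f rootIn + 0)) (+-identityʳ (f rootIn)))
  single rootDominated = trans (+-identityʳ (f rootDominated + 0)) (+-identityʳ (f rootDominated))
  single rootFree      = +-identityʳ (f rootFree)
  single inadmissible  = refl

infix 7 _·_
_·_ : (Class → ℕ) → (Class → ℕ) → ℕ
f · v = classSum (λ c → f c * v c)

·-congʳ : ∀ (f : Class → ℕ) {v w : Class → ℕ} → (∀ c → v c ≡ w c) → f · v ≡ f · w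
·-congʳ f v≡w = classSum-cong (λ c → cong (f c *_) (v≡w c))

·-distribʳ-+ : ∀ (f v w : Class → ℕ) → f · (λ c → v c + w c) ≡ f · v + f · w
·-distribʳ-+ f v w = trans (classSum-cong (λ c → *-distribˡ-+ (f c) (v c) (w c)))
                             (classSum-+ (λ c → f c * v c) (λ c → f c * w c))

·-distribˡ-+ : ∀ (f g v : Class → ℕ) → (λ c → f c + g c) · v ≡ f · v + g · v
·-distribˡ-+ f g v = trans (classSum-cong (λ c → *-distribʳ-+ (v c) (f c) (g c)))
                             (classSum-+ (λ c → f c * v c) (λ c → g c * v c))

·-transpose : ∀ (f : Class → ℕ) (M : Class → Class → ℕ) (v : Class → ℕ) →
  f · (λ c → M c · v) ≡ (λ c′ → classSum (λ c → f c * M c c′)) · v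
·-transpose f M v = begin
  classSum (λ c → f c * classSum (λ c′ → M c c′ * v c′))
    ≡⟨ classSum-cong (λ c → classSum-*ˡ (f c) (λ c′ → M c c′ * v c′)) ⟩
  classSum (λ c → classSum (λ c′ → f c * (M c c′ * v c′)))
    ≡⟨ classSum-cong (λ c → classSum-cong (λ c′ → sym (*-assoc (f c) (M c c′) (v c′)))) ⟩
  classSum (λ c → classSum (λ c′ → f c * M c c′ * v c′))
    ≡⟨ classSum-comm (λ c c′ → f c * M c c′ * v c′) ⟩
  classSum (λ c′ → classSum (λ c → f c * M c c′ * v c′))
    ≡⟨ classSum-cong (λ c′ → sym (classSum-*ʳ (λ c → f c * M c c′) (v c′))) ⟩
  (λ c′ → classSum (λ c → f c * M c c′)) · v ∎

census : ∀ {A : Set} → (A → Class) → List A → Class → ℕ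
census φ xs c = count (λ x → c == φ x) xs

count-census : ∀ {A : Set} (h : Class → Bool) (φ : A → Class) xs →
               count (h ∘ φ) xs ≡ (indicator ∘ h) · census φ xs
count-census h φ []       = sym (classSum-cong (λ c → *-zeroʳ (indicator (h c))))
count-census h φ (x ∷ xs) = begin
  indicator (h (φ x)) + count (h ∘ φ) xs
    ≡⟨ cong₂ _+_ (sym (classSum-indicator (indicator ∘ h) (φ x))) (count-census h φ xs) ⟩
  (indicator ∘ h) · (λ c → indicator (c == φ x)) + (indicator ∘ h) · census φ xs
    ≡⟨ sym (·-distribʳ-+ (indicator ∘ h) (λ c → indicator (c == φ x)) (census φ xs)) ⟩
  (indicator ∘ h) · census φ (x ∷ xs) ∎

classCounts : ℕ → Class → ℕ
classCounts n = census classify (allSubsets (suc (5 * n)))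

extendVec : Vec Bool 5 → Class → Class
extendVec (b0 ∷ b1 ∷ b2 ∷ b3 ∷ b4 ∷ []) = extend b0 b1 b2 b3 b4

classify-++ : ∀ (v : Vec Bool 5) {m} (w : Vec Bool (suc m)) →
              classify (v ++ᵛ w) ≡ extendVec v (classify w)
classify-++ (b0 ∷ b1 ∷ b2 ∷ b3 ∷ b4 ∷ []) (t ∷ w) = refl

transitions : Class → Class → ℕ
transitions c c′ = sumOverVecs 5 (λ v → indicator (c == extendVec v c′))

sumOverVecs-· : ∀ k (F : Vec Bool k → Class → ℕ) (v : Class → ℕ) →
                sumOverVecs k (λ u → F u · v) ≡ (λ c → sumOverVecs k (λ u → F u c)) · v
sumOverVecs-· zero    F v = refl
sumOverVecs-· (suc k) F v =
  trans (cong₂ _+_ (sumOverVecs-· k (F ∘ (false ∷_)) v) (sumOverVecs-· k (F ∘ (true ∷_)) v))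
        (sym (·-distribˡ-+ (λ c → sumOverVecs k (λ u → F (false ∷ u) c))
                           (λ c → sumOverVecs k (λ u → F (true ∷ u) c)) v))

classCounts-suc : ∀ n c → classCounts (suc n) c ≡ transitions c · classCounts n
classCounts-suc n c = begin
  count (λ S → c == classify S) (allSubsets (suc (5 * suc n)))
    ≡⟨ cong (λ m → count (λ S → c == classify {m} S) (allSubsets m)) (cong suc (*-suc 5 n)) ⟩
  count (λ S → c == classify S) (allSubsets (5 + suc (5 * n)))
    ≡⟨ count-allSubsets-+ 5 {suc (5 * n)} (λ S → c == classify S) ⟩
  sumOverVecs 5 (λ v → count (λ w → c == classify (v ++ᵛ w)) rest)
    ≡⟨ sumOverVecs-cong 5 (λ v → count-cong (λ w → cong (c ==_) (classify-++ v w)) rest) ⟩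
  sumOverVecs 5 (λ v → count (λ w → c == extendVec v (classify w)) rest)
    ≡⟨ sumOverVecs-cong 5 (λ v → count-census (λ c′ → c == extendVec v c′) classify rest) ⟩
  sumOverVecs 5 (λ v → (λ c′ → indicator (c == extendVec v c′)) · classCounts n)
    ≡⟨ sumOverVecs-· 5 (λ v c′ → indicator (c == extendVec v c′)) (classCounts n) ⟩
  transitions c · classCounts n ∎
  where
  rest : List (Vec Bool (suc (5 * n)))
  rest = allSubsets (suc (5 * n))

pullback : (Class → ℕ) → Class → ℕ
pullback f c′ = classSum (λ c → f c * transitions c c′)

·-classCounts-suc : ∀ (f : Class → ℕ) n → f · classCounts (suc n) ≡ pullback f · classCounts n
·-classCounts-suc f n =
  trans (·-congʳ f (classCounts-suc n)) (·-transpose f transitions (classCounts n))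

maximalForm : Class → ℕ
maximalForm = indicator ∘ isMaximalClass

g≡maximalForm : ∀ n → g n ≡ maximalForm · classCounts n
g≡maximalForm n = begin
  length (filter (isMaximalIndependent? (paraHexCactus n)) subsets)
    ≡⟨ length-filter (isMaximalIndependent? (paraHexCactus n)) subsets ⟩
  count (does ∘ isMaximalIndependent? (paraHexCactus n)) subsets
    ≡⟨ count-cong (maximalIndependent?≡ n) subsets ⟩
  count (isMaximalClass ∘ classify) subsets
    ≡⟨ count-census isMaximalClass classify subsets ⟩
  maximalForm · classCounts n ∎
  where
  subsets : List (Vec Bool (suc (5 * n)))
  subsets = allSubsets (suc (5 * n))

pullback^ : ℕ → (Class → ℕ) → Class → ℕ
pullback^ zero    f = f
pullback^ (suc j) f = pullback (pullback^ j f)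

g≡pullback^ : ∀ j k → g (j + k) ≡ pullback^ j maximalForm · classCounts k
g≡pullback^ zero    k = g≡maximalForm k
g≡pullback^ (suc j) k = begin
  g (suc (j + k))                                  ≡⟨ cong g (sym (+-suc j k)) ⟩
  g (j + suc k)                                    ≡⟨ g≡pullback^ j (suc k) ⟩
  pullback^ j maximalForm · classCounts (suc k)    ≡⟨ ·-classCounts-suc (pullback^ j maximalForm) k ⟩
  pullback^ (suc j) maximalForm · classCounts k    ∎

-- Stated for g j itself: checking g (j + 0) against g j by evaluation would
-- enumerate all subsets.
g≡pullback^₀ : ∀ j → g j ≡ pullback^ j maximalForm · classCounts 0
g≡pullback^₀ j =
  subst (λ n → g n ≡ pullback^ j maximalForm · classCounts 0) (+-identityʳ j) (g≡pullback^ j 0)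

pullback^-recurrence : ∀ v →
  pullback^ 4 maximalForm · v + 4 * (pullback^ 2 maximalForm · v) ≡
  5 * (pullback^ 3 maximalForm · v) + pullback^ 1 maximalForm · v
pullback^-recurrence v = identity (v rootIn) (v rootDominated) (v rootFree) (v inadmissible)
  where
  -- The coefficients are the values of pullback^ k maximalForm, k = 4, 2, 3, 1, on the
  -- classes rootIn, rootDominated, rootFree, inadmissible.
  identity : ∀ a b c d →
    93 * a + 286 * b + 216 * c + 0 * d + 4 * (6 * a + 17 * b + 13 * c + 0 * d) ≡
    5 * (23 * a + 70 * b + 53 * c + 0 * d) + (2 * a + 4 * b + 3 * c + 0 * d)
  identity = solve-∀

theorem2p19 : (g 1 ≡ 5) × (g 2 ≡ 19) × (g 3 ≡ 76) ×
    (∀ n → n ≥ 4 → g n + 4 * g (n ∸ 2) ≡ 5 * g (n ∸ 1) + g (n ∸ 3))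
theorem2p19 = g≡pullback^₀ 1 , g≡pullback^₀ 2 , g≡pullback^₀ 3 , recurrence
  where
  recurrence : ∀ n → n ≥ 4 → g n + 4 * g (n ∸ 2) ≡ 5 * g (n ∸ 1) + g (n ∸ 3)
  recurrence _ (s≤s (s≤s (s≤s (s≤s {n = k} _)))) = begin
    g (4 + k) + 4 * g (2 + k)
      ≡⟨ cong₂ (λ x y → x + 4 * y) (g≡pullback^ 4 k) (g≡pullback^ 2 k) ⟩
    pullback^ 4 maximalForm · classCounts k + 4 * (pullback^ 2 maximalForm · classCounts k)
      ≡⟨ pullback^-recurrence (classCounts k) ⟩
    5 * (pullback^ 3 maximalForm · classCounts k) + pullback^ 1 maximalForm · classCounts k
      ≡⟨ sym (cong₂ (λ x y → 5 * x + y) (g≡pullback^ 3 k) (g≡pullback^ 1 k)) ⟩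
    5 * g (3 + k) + g (1 + k) ∎
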